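{- Let $a_1,\dots,a_n$ be positive integers and $k\ge 2$, $M$ integers with $\sum_{i=1}^n a_i = kM$ and $M-a_i-2\ge 0$ for all $i$, and let $D$, $s$, $t$ and $\ell=(n+2k-2)M$ be as in the construction described in the context. If there is a partition of $\{1,\dots,n\}$ into $k$ sets $I_0,\dots,I_{k-1}$ with $\sum_{j\in I_q} a_j = M$ for every $q$, then there are $2k$ paths $P_0, \dots, P_{2k-1}$ from $s$ to $t$ in $D$ such that $|P_i \triangle P_{i'}| \ge 2\ell - 2M$ for all $0 \le i < i' \le 2k-1$.
   Context: Paths are identified with their arc sets; $\triangle$ is symmetric difference. Construction of the unweighted directed graph $D$: all gadgets below are vertex-disjoint except for the identifications stated. Let "a copy of $P$" mean a directed path with $M-2$ arcs. The block $H$ consists of $k$ copies of $P$ together with two new vertices $u,v$, an arc from $u$ to the first vertex of each copy and an arc from the last vertex of each copy to $v$. Take $2k-2$ copies $H_1,\dots,H_{2k-2}$ of $H$, with $u_j,v_j$ the vertices $u,v$ of $H_j$, and identify $v_j$ with $u_{j+1}$ for $1\le j\le 2k-3$; set $s=u_1$ and $r=v_{2k-2}$ (this is the part $D_1$). For each $1\le i\le n$, build $H'_i$: vertices $p_i,q_i$; $2k-2$ copies of $P$, each with an arc from $p_i$ to its first vertex and an arc from its last vertex to $q_i$; a directed path $Q_i$ with $a_i-1$ arcs and two directed paths $Q'_i,Q''_i$ with $M-a_i-2$ arcs each; arcs from $p_i$ to the first vertex of $Q_i$, from the last vertex of $Q_i$ to the first vertex of $Q'_i$ and to the first vertex of $Q''_i$,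 and from the last vertices of $Q'_i$ and $Q''_i$ to $q_i$. Identify $q_i$ with $p_{i+1}$ for $1\le i\le n-1$, identify $r$ with $p_1$, and set $t=q_n$. Every $s$–$t$ path in $D$ has exactly $\ell=(n+2k-2)M$ arcs. -}

module Defs where

open import Data.Nat as ℕ using (ℕ; zero; suc; _+_; _*_; _∸_; _≤_; _<_)
open import Data.Fin using (Fin; toℕ)
open import Data.Bool using (if_then_else_)
open import Data.Product using (_×_; _,_; Σ)
open import Data.Product.Properties using (≡-dec)
open import Data.List using (List; []; _∷_; length; filter)
open import Data.List.Relation.Unary.Unique.Propositional using (Unique)
open import Relation.Binary.PropositionalEquality using (_≡_; refl)
open import Relation.Binary.Definitions using (DecidableEquality)
open import Relation.Nullary using (yes; no; ¬?; does)
import Data.List.Membership.DecPropositional as DecMem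

ΣFin : (n : ℕ) → (Fin n → ℕ) → ℕ
ΣFin zero    f = 0
ΣFin (suc n) f = f Fin.zero + ΣFin n (λ i → f (Fin.suc i))
  where import Data.Fin as Fin

-- Vertices of D (all indices 0-based).
--   junc j      : the "junction" vertices.  junc 0 = s = u_1,
--                 junc j = v_j = u_{j+1} (D_1 blocks), junc (2k-2) = r = p_1,
--                 junc (2k-2+i) = q_i = p_{i+1}, junc (2k-2+n) = t = q_n.
--   dP j c p    : position p (0..M-2) on copy c (< k) of P in block H_{j+1}
--   hP i c p    : position p (0..M-2) on copy c (< 2k-2) of P in H'_{i+1}
--   hQ i p      : position p (0..a_i - 1) on Q_{i+1}
--   hQ' i p     : position p (0..M-a_i-2) on Q'_{i+1}
--   hQ'' i p    : position p (0..M-a_i-2) on Q''_{i+1}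

data V : Set where
  junc : ℕ → V
  dP   : (j c p : ℕ) → V
  hP   : (i c p : ℕ) → V
  hQ   : (i p : ℕ) → V
  hQ'  : (i p : ℕ) → V
  hQ'' : (i p : ℕ) → V

private
  ≡-dec2 : DecidableEquality (ℕ × ℕ)
  ≡-dec2 = ≡-dec ℕ._≟_ ℕ._≟_
  ≡-dec3 : DecidableEquality (ℕ × ℕ × ℕ)
  ≡-dec3 = ≡-dec ℕ._≟_ ≡-dec2

_≟V_ : DecidableEquality V
(junc x0) ≟V (junc y0) with x0 ℕ.≟ y0
... | yes refl = yes refl
... | no ne = no λ { refl → ne refl }
(junc _) ≟V (dP _ _ _) = no λ ()
(junc _) ≟V (hP _ _ _) = no λ ()
(junc _) ≟V (hQ _ _) = no λ ()
(junc _) ≟V (hQ' _ _) = no λ ()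
(junc _) ≟V (hQ'' _ _) = no λ ()
(dP _ _ _) ≟V (junc _) = no λ ()
(dP x0 x1 x2) ≟V (dP y0 y1 y2) with ≡-dec3 (x0 , x1 , x2) (y0 , y1 , y2)
... | yes refl = yes refl
... | no ne = no λ { refl → ne refl }
(dP _ _ _) ≟V (hP _ _ _) = no λ ()
(dP _ _ _) ≟V (hQ _ _) = no λ ()
(dP _ _ _) ≟V (hQ' _ _) = no λ ()
(dP _ _ _) ≟V (hQ'' _ _) = no λ ()
(hP _ _ _) ≟V (junc _) = no λ ()
(hP _ _ _) ≟V (dP _ _ _) = no λ ()
(hP x0 x1 x2) ≟V (hP y0 y1 y2) with ≡-dec3 (x0 , x1 , x2) (y0 , y1 , y2)
... | yes refl = yes refl
... | no ne = no λ { refl → ne refl }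
(hP _ _ _) ≟V (hQ _ _) = no λ ()
(hP _ _ _) ≟V (hQ' _ _) = no λ ()
(hP _ _ _) ≟V (hQ'' _ _) = no λ ()
(hQ _ _) ≟V (junc _) = no λ ()
(hQ _ _) ≟V (dP _ _ _) = no λ ()
(hQ _ _) ≟V (hP _ _ _) = no λ ()
(hQ x0 x1) ≟V (hQ y0 y1) with ≡-dec2 (x0 , x1) (y0 , y1)
... | yes refl = yes refl
... | no ne = no λ { refl → ne refl }
(hQ _ _) ≟V (hQ' _ _) = no λ ()
(hQ _ _) ≟V (hQ'' _ _) = no λ ()
(hQ' _ _) ≟V (junc _) = no λ ()
(hQ' _ _) ≟V (dP _ _ _) = no λ ()
(hQ' _ _) ≟V (hP _ _ _) = no λ ()
(hQ' _ _) ≟V (hQ _ _) = no λ ()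
(hQ' x0 x1) ≟V (hQ' y0 y1) with ≡-dec2 (x0 , x1) (y0 , y1)
... | yes refl = yes refl
... | no ne = no λ { refl → ne refl }
(hQ' _ _) ≟V (hQ'' _ _) = no λ ()
(hQ'' _ _) ≟V (junc _) = no λ ()
(hQ'' _ _) ≟V (dP _ _ _) = no λ ()
(hQ'' _ _) ≟V (hP _ _ _) = no λ ()
(hQ'' _ _) ≟V (hQ _ _) = no λ ()
(hQ'' _ _) ≟V (hQ' _ _) = no λ ()
(hQ'' x0 x1) ≟V (hQ'' y0 y1) with ≡-dec2 (x0 , x1) (y0 , y1)
... | yes refl = yes refl
... | no ne = no λ { refl → ne refl }

_≟E_ : DecidableEquality (V × V)
_≟E_ = ≡-dec _≟V_ _≟V_

-- The arc relation of the digraph D = D(n, k, M, a).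
-- L = 2k-2 is the number of blocks H_j and the number of P-copies in H'_i.

module Construction (n k M : ℕ) (a : Fin n → ℕ) where

  L : ℕ
  L = 2 * k ∸ 2

  s : V
  s = junc 0

  r : V
  r = junc L

  t : V
  t = junc (L + n)

  ℓ : ℕ
  ℓ = (n + L) * M

  data Arc : V → V → Set where
    -- D_1: block H_{j+1} has u = junc j, v = junc (j+1); k copies of P (M-2 arcs)
    d-in   : ∀ {j c} → j < L → c < k → Arc (junc j) (dP j c 0)
    d-step : ∀ {j c p} → j < L → c < k → suc (suc p) < M →
             Arc (dP j c p) (dP j c (suc p))
    d-out  : ∀ {j c} → j < L → c < k → Arc (dP j c (M ∸ 2)) (junc (suc j))
    -- H'_{i+1}: p = junc (L + i), q = junc (L + i + 1); 2k-2 copies of P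
    h-in   : ∀ {i : Fin n} {c} → c < L → Arc (junc (L + toℕ i)) (hP (toℕ i) c 0)
    h-step : ∀ {i : Fin n} {c p} → c < L → suc (suc p) < M →
             Arc (hP (toℕ i) c p) (hP (toℕ i) c (suc p))
    h-out  : ∀ {i : Fin n} {c} → c < L →
             Arc (hP (toℕ i) c (M ∸ 2)) (junc (L + suc (toℕ i)))
    -- Q_{i+1}: a_i - 1 arcs (positions 0 .. a_i - 1)
    q-in   : ∀ {i : Fin n} → Arc (junc (L + toℕ i)) (hQ (toℕ i) 0)
    q-step : ∀ {i : Fin n} {p} → suc p < a i → Arc (hQ (toℕ i) p) (hQ (toℕ i) (suc p))
    -- Q'_{i+1}, Q''_{i+1}: M - a_i - 2 arcs each (positions 0 .. M - a_i - 2)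
    q'-in   : ∀ {i : Fin n} → Arc (hQ (toℕ i) (a i ∸ 1)) (hQ' (toℕ i) 0)
    q'-step : ∀ {i : Fin n} {p} → suc p + a i + 2 ≤ M →
              Arc (hQ' (toℕ i) p) (hQ' (toℕ i) (suc p))
    q'-out  : ∀ {i : Fin n} → Arc (hQ' (toℕ i) (M ∸ a i ∸ 2)) (junc (L + suc (toℕ i)))
    q''-in   : ∀ {i : Fin n} → Arc (hQ (toℕ i) (a i ∸ 1)) (hQ'' (toℕ i) 0)
    q''-step : ∀ {i : Fin n} {p} → suc p + a i + 2 ≤ M →
               Arc (hQ'' (toℕ i) p) (hQ'' (toℕ i) (suc p))
    q''-out  : ∀ {i : Fin n} → Arc (hQ'' (toℕ i) (M ∸ a i ∸ 2)) (junc (L + suc (toℕ i)))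

data Walk (A : V → V → Set) : V → V → Set where
  stop : ∀ x → Walk A x x
  step : ∀ {x y z} → A x y → Walk A y z → Walk A x z

verts : ∀ {A x y} → Walk A x y → List V
verts (stop x)         = x ∷ []
verts (step {x} _ w)   = x ∷ verts w

arcs : ∀ {A x y} → Walk A x y → List (V × V)
arcs (stop x)           = []
arcs (step {x} {y} _ w) = (x , y) ∷ arcs w

Path : (V → V → Set) → V → V → Set
Path A x y = Σ (Walk A x y) (λ w → Unique (verts w))

open DecMem _≟E_ using (_∈?_)

-- |X △ Y| for duplicate-free arc lists X, Y:
-- (#arcs of X not in Y) + (#arcs of Y not in X)
symDiffSize : List (V × V) → List (V × V) → ℕ
symDiffSize xs ys =
  length (filter (λ e → ¬? (e ∈? ys)) xs) + length (filter (λ e → ¬? (e ∈? xs)) ys)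

-- Partition of {1..n} into k labelled sets I_0..I_{k-1}, given by f (j ∈ I_{f j}):
-- the sum of a_j over I_q
partSum : ∀ {n k} → (Fin n → ℕ) → (Fin n → Fin k) → Fin k → ℕ
partSum {n} a f q = ΣFin n (λ j → if does (f j Data.Fin.≟ q) then a j else 0)
  where import Data.Fin

{-# OPTIONS --safe #-}
-- The 2k paths are indexed by the players 0, …, N (N = 2k − 1) of the round-robin
-- 1-factorisation of K_{2k}: players x < N sit on ℤ/N, N is a point at infinity, and round m
-- pairs x with 2m − x (and m with N). Labelling each pair of round m by the cyclic distance
-- from x to m gives the k pairs distinct labels < k, and in block H_m of D₁ (1 ≤ m ≤ 2k − 2)
-- both members of a pair take the copy of P with that label. The pairs of round 0 are the
-- groups {q, N − q}: in H'_i the two members of group f i take Q_i followed by Q'_i resp.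
-- Q''_i, and every other player takes a copy of P of its own. Two distinct players are paired
-- in at most one round, so they share the M arcs of one copy of P in D₁, or (when in the same
-- group q) the paths Q_i with f i = q, of total length Σ_{i ∈ I_q} a_i = M, and nothing else.
-- Every s–t path has ℓ arcs, hence the symmetric difference has at least 2ℓ − 2M arcs.
module Submission where

open import Defs
open import Data.Nat using (ℕ; NonZero; zero; suc; _+_; _*_; _∸_; _≤_; _<_; _⊓_; z≤n; s≤s; _≟_; _<?_; _≤?_)
open import Data.Nat.Properties
open import Algebra.Properties.CommutativeSemigroup +-commutativeSemigroup using (interchange; x∙yz≈y∙xz)
open import Data.Nat.DivMod using (_%_; %-distribˡ-+; %-distribˡ-*; m%n%n≡m%n; [m+n]%n≡m%n; [m+kn]%n≡m%n; m<n⇒m%n≡m; m%n<n)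
open import Data.Nat.Tactic.RingSolver using (solve-∀)
open import Data.Fin as Fin using (Fin; toℕ; fromℕ<; zero; suc)
import Data.Fin.Properties as Finₚ
open import Data.List using (List; []; _∷_; _++_; length; filter)
open import Data.List.Properties using (length-++; filter-++; length-filter; filter-none)
open import Data.List.Relation.Unary.All as All using (All; []; _∷_)
open import Data.List.Relation.Unary.All.Properties using (++⁺)
open import Data.List.Relation.Unary.AllPairs using (_∷_; [])
open import Data.List.Relation.Unary.Unique.Propositional using (Unique)
import Data.List.Membership.DecPropositional as DecMembership
open import Data.Product using (Σ; ∃-syntax; _×_; _,_; proj₁; proj₂)
open import Data.Product.Relation.Binary.Lex.Strict using (×-strictPartialOrder)
open import Data.Sum using (_⊎_; inj₁; inj₂)
open import Data.Empty using (⊥)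
open import Data.Bool using (if_then_else_)
open import Function using (_∘_)
open import Relation.Binary.Bundles using (StrictPartialOrder)
open import Relation.Binary.PropositionalEquality
open import Relation.Nullary using (¬_; Dec; yes; no; ¬?; does; contradiction)
open import Relation.Unary using (Pred; Decidable; ∁)

open DecMembership _≟E_ using (_∈?_)

private variable
  u v w x y z : V

count : ∀ {a p} {A : Set a} {P : Pred A p} → Decidable P → List A → ℕ
count P? xs = length (filter P? xs)

module _ {a p} {A : Set a} {P : Pred A p} (P? : Decidable P) where

  count-++ : ∀ xs ys → count P? (xs ++ ys) ≡ count P? xs + count P? ys
  count-++ xs ys = trans (cong length (filter-++ P? xs ys)) (length-++ (filter P? xs))

  count≤length : ∀ xs → count P? xs ≤ length xs
  count≤length = length-filter P?

  count-none : ∀ {xs} → All (∁ P) xs → count P? xs ≡ 0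
  count-none ¬Ps = cong length (filter-none P? ¬Ps)

  count-complement : ∀ xs → count (¬? ∘ P?) xs + count P? xs ≡ length xs
  count-complement []       = refl
  count-complement (x ∷ xs) with P? x
  ... | yes _ = trans (+-suc _ _) (cong suc (count-complement xs))
  ... | no _  = cong suc (count-complement xs)

module _ {a p q} {A : Set a} {P : Pred A p} {Q : Pred A q} (P? : Decidable P) (Q? : Decidable Q) where

  count-mono : ∀ {xs} → All (λ x → P x → Q x) xs → count P? xs ≤ count Q? xs
  count-mono []                = z≤n
  count-mono {x ∷ _} (P⇒Q ∷ rest) with P? x | Q? x
  ... | yes _  | yes _  = s≤s (count-mono rest)
  ... | yes Px | no ¬Qx = contradiction (P⇒Q Px) ¬Qx
  ... | no _   | yes _  = m≤n⇒m≤1+n (count-mono rest)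
  ... | no _   | no _   = count-mono rest

ΣFin-mono : ∀ m {g h : Fin m → ℕ} → (∀ i → g i ≤ h i) → ΣFin m g ≤ ΣFin m h
ΣFin-mono zero    _   = z≤n
ΣFin-mono (suc m) g≤h = +-mono-≤ (g≤h zero) (ΣFin-mono m (λ i → g≤h (suc i)))

ΣFin-cong : ∀ m {g h : Fin m → ℕ} → (∀ i → g i ≡ h i) → ΣFin m g ≡ ΣFin m h
ΣFin-cong zero    _   = refl
ΣFin-cong (suc m) g≡h = cong₂ _+_ (g≡h zero) (ΣFin-cong m (λ i → g≡h (suc i)))

ΣFin-const : ∀ m c → ΣFin m (λ _ → c) ≡ m * c
ΣFin-const zero    c = refl
ΣFin-const (suc m) c = cong (c +_) (ΣFin-const m c)

ΣFin-zero : ∀ m → ΣFin m (λ _ → 0) ≡ 0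
ΣFin-zero m = trans (ΣFin-const m 0) (*-zeroʳ m)

ΣFin-≤-single : ∀ m {g : Fin m → ℕ} {c} → (∀ i → g i ≤ c) →
                (∀ i j → g i ≢ 0 → g j ≢ 0 → i ≡ j) → ΣFin m g ≤ c
ΣFin-≤-single zero    _   _      = z≤n
ΣFin-≤-single (suc m) {g} {c} g≤c single with g zero ≟ 0
... | yes g₀≡0 = begin
  g zero + ΣFin m (λ i → g (suc i)) ≡⟨ cong (_+ ΣFin m (λ i → g (suc i))) g₀≡0 ⟩
  ΣFin m (λ i → g (suc i))          ≤⟨ ΣFin-≤-single m (λ i → g≤c (suc i)) single-suc ⟩
  c                                 ∎
  where
  open ≤-Reasoning
  single-suc : ∀ i j → g (suc i) ≢ 0 → g (suc j) ≢ 0 → i ≡ j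
  single-suc i j gᵢ≢0 gⱼ≢0 = Finₚ.suc-injective (single (suc i) (suc j) gᵢ≢0 gⱼ≢0)
... | no g₀≢0 = begin
  g zero + ΣFin m (λ i → g (suc i)) ≤⟨ +-monoʳ-≤ (g zero) (ΣFin-mono m rest≤0) ⟩
  g zero + ΣFin m (λ _ → 0)         ≡⟨ cong (g zero +_) (ΣFin-zero m) ⟩
  g zero + 0                        ≡⟨ +-identityʳ (g zero) ⟩
  g zero                            ≤⟨ g≤c zero ⟩
  c                                 ∎
  where
  open ≤-Reasoning
  rest≤0 : ∀ i → g (suc i) ≤ 0
  rest≤0 i with g (suc i) ≟ 0
  ... | yes gᵢ≡0 = ≤-reflexive gᵢ≡0
  ... | no gᵢ≢0  = contradiction (single zero (suc i) g₀≢0 gᵢ≢0) λ ()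

symDiffSize-≥ : ∀ {ℓ m} (xs ys : List (V × V)) → length xs ≡ ℓ → length ys ≡ ℓ →
                count (_∈? ys) xs ≤ m → count (_∈? xs) ys ≤ m →
                2 * ℓ ∸ 2 * m ≤ symDiffSize xs ys
symDiffSize-≥ {ℓ} {m} xs ys |xs|≡ℓ |ys|≡ℓ xs∩ys≤m ys∩xs≤m = begin
  2 * ℓ ∸ 2 * m           ≡⟨ *-distribˡ-∸ 2 ℓ m ⟨
  2 * (ℓ ∸ m)             ≡⟨ cong ((ℓ ∸ m) +_) (+-identityʳ (ℓ ∸ m)) ⟩
  (ℓ ∸ m) + (ℓ ∸ m)       ≤⟨ +-mono-≤ (unshared xs ys |xs|≡ℓ xs∩ys≤m) (unshared ys xs |ys|≡ℓ ys∩xs≤m) ⟩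
  symDiffSize xs ys       ∎
  where
  open ≤-Reasoning
  unshared : ∀ zs ws → length zs ≡ ℓ → count (_∈? ws) zs ≤ m → ℓ ∸ m ≤ count (¬? ∘ (_∈? ws)) zs
  unshared zs ws |zs|≡ℓ shared≤m = begin
    ℓ ∸ m                      ≤⟨ ∸-monoʳ-≤ ℓ shared≤m ⟩
    ℓ ∸ inside                 ≡⟨ cong (_∸ inside) (trans (sym |zs|≡ℓ) (sym (count-complement (_∈? ws) zs))) ⟩
    outside + inside ∸ inside  ≡⟨ m+n∸n≡m outside inside ⟩
    outside                    ∎
    where
    inside outside : ℕ
    inside  = count (_∈? ws) zs
    outside = count (¬? ∘ (_∈? ws)) zs

module _ {A : V → V → Set} where

  infixr 5 _++ᵂ_

  _++ᵂ_ : Walk A x y → Walk A y z → Walk A x z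
  stop _   ++ᵂ q = q
  step e p ++ᵂ q = step e (p ++ᵂ q)

  arcs-++ᵂ : (p : Walk A x y) (q : Walk A y z) → arcs (p ++ᵂ q) ≡ arcs p ++ arcs q
  arcs-++ᵂ (stop _)   q = refl
  arcs-++ᵂ (step e p) q = cong (_ ∷_) (arcs-++ᵂ p q)

  All-++ᵂ : ∀ {P : V × V → Set} (p : Walk A x y) (q : Walk A y z) →
            All P (arcs p) → All P (arcs q) → All P (arcs (p ++ᵂ q))
  All-++ᵂ p q Pp Pq = subst (All _) (sym (arcs-++ᵂ p q)) (++⁺ Pp Pq)

  length-++ᵂ : (p : Walk A x y) (q : Walk A y z) → length (arcs (p ++ᵂ q)) ≡ length (arcs p) + length (arcs q)
  length-++ᵂ p q = trans (cong length (arcs-++ᵂ p q)) (length-++ (arcs p))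

  castSource : x ≡ y → Walk A x z → Walk A y z
  castSource refl p = p

  arcs-castSource : (eq : x ≡ y) (p : Walk A x z) → arcs (castSource eq p) ≡ arcs p
  arcs-castSource refl p = refl

  wrap : A u v → Walk A v w → A w x → Walk A u x
  wrap e p e′ = step e (p ++ᵂ step e′ (stop _))

  length-wrap : (e : A u v) (p : Walk A v w) (e′ : A w x) →
                length (arcs (wrap e p e′)) ≡ 2 + length (arcs p)
  length-wrap e p e′ = cong suc (trans (cong length (arcs-++ᵂ p _)) (trans (length-++ (arcs p)) (+-comm (length (arcs p)) 1)))

  All-wrap : ∀ {P : V × V → Set} (e : A u v) (p : Walk A v w) (e′ : A w x) →
             P (u , v) → All P (arcs p) → P (w , x) → All P (arcs (wrap e p e′))
  All-wrap e p e′ Pe Pp Pe′ = Pe ∷ All-++ᵂ p _ Pp (Pe′ ∷ [])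

  walkAlong : (F : ℕ → V) (b : ℕ) → (∀ i → i < b → A (F i) (F (suc i))) → Walk A (F 0) (F b)
  walkAlong F zero    _    = stop _
  walkAlong F (suc b) arc = step (arc 0 (s≤s z≤n)) (walkAlong (λ i → F (suc i)) b (λ i i<b → arc (suc i) (s≤s i<b)))

  length-walkAlong : ∀ F b arc → length (arcs (walkAlong F b arc)) ≡ b
  length-walkAlong F zero    _   = refl
  length-walkAlong F (suc b) arc = cong suc (length-walkAlong (λ i → F (suc i)) b _)

  All-walkAlong : ∀ {P : V × V → Set} F b arc → (∀ i → P (F i , F (suc i))) → All P (arcs (walkAlong F b arc))
  All-walkAlong F zero    _   _  = []
  All-walkAlong F (suc b) arc PF = PF 0 ∷ All-walkAlong (λ i → F (suc i)) b _ (λ i → PF (suc i))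

  concatWalks : ∀ m (J : ℕ → V) → ((i : Fin m) → Walk A (J (toℕ i)) (J (suc (toℕ i)))) → Walk A (J 0) (J m)
  concatWalks zero    J _   = stop _
  concatWalks (suc m) J seg = seg zero ++ᵂ concatWalks m (λ j → J (suc j)) (λ i → seg (suc i))

  concatWalks-additive : (φ : List (V × V) → ℕ) → φ [] ≡ 0 → (∀ es fs → φ (es ++ fs) ≡ φ es + φ fs) →
                     ∀ m J seg → φ (arcs (concatWalks m J seg)) ≡ ΣFin m (λ i → φ (arcs (seg i)))
  concatWalks-additive φ φ[] φ++ zero    J seg = φ[]
  concatWalks-additive φ φ[] φ++ (suc m) J seg = begin
    φ (arcs (seg zero ++ᵂ rest))         ≡⟨ cong φ (arcs-++ᵂ (seg zero) rest) ⟩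
    φ (arcs (seg zero) ++ arcs rest)     ≡⟨ φ++ (arcs (seg zero)) (arcs rest) ⟩
    φ (arcs (seg zero)) + φ (arcs rest)  ≡⟨ cong (φ (arcs (seg zero)) +_) (concatWalks-additive φ φ[] φ++ m _ _) ⟩
    ΣFin (suc m) (λ i → φ (arcs (seg i))) ∎
    where
    open ≡-Reasoning
    rest = concatWalks m (λ j → J (suc j)) (λ i → seg (suc i))

  All-concatWalks : ∀ {P : V × V → Set} m J seg → (∀ i → All P (arcs (seg i))) → All P (arcs (concatWalks m J seg))
  All-concatWalks zero    J seg Pseg = []
  All-concatWalks (suc m) J seg Pseg = All-++ᵂ (seg zero) _ (Pseg zero) (All-concatWalks m _ _ (λ i → Pseg (suc i)))

module _ {A : V → V → Set} {c ℓ₁ ℓ₂} (O : StrictPartialOrder c ℓ₁ ℓ₂) where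
  open StrictPartialOrder O renaming (_<_ to _≺_; trans to ≺-trans)

  module _ (rank : V → Carrier) (rank-increasing : ∀ {x y} → A x y → rank x ≺ rank y) where

    private
      above : A x y → (p : Walk A y z) → All (λ v → rank x ≺ rank v) (verts p)
      above e (stop _)    = rank-increasing e ∷ []
      above e (step e′ p) = rank-increasing e ∷ All.map (≺-trans (rank-increasing e)) (above e′ p)

    walk-unique : (p : Walk A x y) → Unique (verts p)
    walk-unique (stop _)   = [] ∷ []
    walk-unique (step e p) = All.map (λ x≺v x≡v → irrefl Eq.refl (subst (λ v → _ ≺ rank v) (sym x≡v) x≺v)) (above e p)
                               ∷ walk-unique p

[m+n%d]%d≡[m+n]%d : ∀ m n d .{{_ : NonZero d}} → (m + n % d) % d ≡ (m + n) % d
[m+n%d]%d≡[m+n]%d m n d = begin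
  (m + n % d) % d             ≡⟨ %-distribˡ-+ m (n % d) d ⟩
  (m % d + n % d % d) % d     ≡⟨ cong (λ r → (m % d + r) % d) (m%n%n≡m%n n d) ⟩
  (m % d + n % d) % d         ≡⟨ %-distribˡ-+ m n d ⟨
  (m + n) % d                 ∎
  where open ≡-Reasoning

[m*n%d]%d≡[m*n]%d : ∀ m n d .{{_ : NonZero d}} → (m * (n % d)) % d ≡ (m * n) % d
[m*n%d]%d≡[m*n]%d m n d = begin
  (m * (n % d)) % d           ≡⟨ %-distribˡ-* m (n % d) d ⟩
  (m % d * (n % d % d)) % d   ≡⟨ cong (λ r → (m % d * r) % d) (m%n%n≡m%n n d) ⟩
  (m % d * (n % d)) % d       ≡⟨ %-distribˡ-* m n d ⟨
  (m * n) % d                 ∎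
  where open ≡-Reasoning

m<n∸o⇒o+m<n : ∀ o {m n} → m < n ∸ o → o + m < n
m<n∸o⇒o+m<n zero            m<n∸o = m<n∸o
m<n∸o⇒o+m<n (suc o) {n = suc n} m<n∸o = s≤s (m<n∸o⇒o+m<n o m<n∸o)

[1+h]*[m+m]≡m+m*[1+h+h] : ∀ h m → suc h * (m + m) ≡ m + m * suc (h + h)
[1+h]*[m+m]≡m+m*[1+h+h] = solve-∀

m<n∸o∸2⇒1+m+o+2≤n : ∀ {m n} o → m < n ∸ o ∸ 2 → suc m + o + 2 ≤ n
m<n∸o∸2⇒1+m+o+2≤n {m} {n} o m<n∸o∸2 = subst (_≤ n) (cong suc rearrange) (m<n∸o⇒o+m<n o (m<n∸o⇒o+m<n 2 m<n∸o∸2))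
  where
  rearrange : o + (2 + m) ≡ m + o + 2
  rearrange = trans (+-comm o (2 + m)) (sym (+-comm (m + o) 2))

≮∧≢⇒> : ∀ {m n} → ¬ m < n → m ≢ n → n < m
≮∧≢⇒> m≮n m≢n = ≤∧≢⇒< (≮⇒≥ m≮n) (m≢n ∘ sym)

dropPoint : ℕ → ℕ → ℕ
dropPoint a x with x <? a
... | yes _ = x
... | no _  = x ∸ 1

dropPoint-below : ∀ {a x} → x < a → dropPoint a x ≡ x
dropPoint-below {a} {x} x<a with x <? a
... | yes _   = refl
... | no x≮a  = contradiction x<a x≮a

dropPoint-< : ∀ {a x n} → a ≤ n → x ≤ n → x ≢ a → dropPoint a x < n
dropPoint-< {a} {x} a≤n x≤n x≢a with x <? a
... | yes x<a = <-≤-trans x<a a≤n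
... | no x≮a  = pred-< (≮∧≢⇒> x≮a x≢a) x≤n
  where
  pred-< : ∀ {x n} → a < x → x ≤ n → x ∸ 1 < n
  pred-< {suc x} _ x<n = x<n

dropPoint-injective : ∀ {a x y} → x ≢ a → y ≢ a → dropPoint a x ≡ dropPoint a y → x ≡ y
dropPoint-injective {a} {x} {y} x≢a y≢a eq with x <? a | y <? a
... | yes _   | yes _   = eq
... | no x≮a  | no y≮a  = ∸-cancelʳ-≡ (above x≮a x≢a) (above y≮a y≢a) eq
  where
  above : ∀ {x} → ¬ x < a → x ≢ a → 1 ≤ x
  above x≮a x≢a = <-≤-trans (s≤s z≤n) (≮∧≢⇒> x≮a x≢a)
... | yes x<a | no y≮a  = contradiction x<a (≤⇒≯ (subst (a ≤_) (sym eq) (∸-monoˡ-≤ 1 (≮∧≢⇒> y≮a y≢a))))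
... | no x≮a  | yes y<a = contradiction y<a (≤⇒≯ (subst (a ≤_) eq (∸-monoˡ-≤ 1 (≮∧≢⇒> x≮a x≢a))))

-- Players are 0, …, N and rounds are m < N; player N plays the point at infinity.
-- label x m < suc h names the pair of player x in round m; the pairs of round 0 are the groups.
module RoundRobin (h : ℕ) where

  N : ℕ
  N = suc (h + h)

  2[1+h]≡1+N : 2 * suc h ≡ suc N
  2[1+h]≡1+N = cong suc (trans (+-suc h (h + 0)) (cong (λ r → suc (h + r)) (+-identityʳ h)))

  fold : ℕ → ℕ
  fold d = d ⊓ (N ∸ d)

  fold≤h : ∀ d → fold d ≤ h
  fold≤h d with d ≤? h
  ... | yes d≤h = ≤-trans (m⊓n≤m d (N ∸ d)) d≤h
  ... | no d≰h  = ≤-trans (m⊓n≤n d (N ∸ d)) (≤-trans (∸-monoʳ-≤ N (≰⇒> d≰h)) (≤-reflexive (m+n∸n≡m h h)))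

  fold-injective : ∀ {d e} → d ≤ N → e ≤ N → fold d ≡ fold e → d ≡ e ⊎ d + e ≡ N
  fold-injective {d} {e} d≤N e≤N eq with ⊓-sel d (N ∸ d) | ⊓-sel e (N ∸ e)
  ... | inj₁ fd | inj₁ fe = inj₁ (trans (sym fd) (trans eq fe))
  ... | inj₁ fd | inj₂ fe = inj₂ (trans (cong (_+ e) (trans (sym fd) (trans eq fe))) (m∸n+n≡m e≤N))
  ... | inj₂ fd | inj₁ fe = inj₂ (trans (cong (d +_) (trans (sym fe) (trans (sym eq) fd))) (m+[n∸m]≡n d≤N))
  ... | inj₂ fd | inj₂ fe = inj₁ (∸-cancelˡ-≡ d≤N e≤N (trans (sym fd) (trans eq fe)))

  fold-reflect : ∀ {d} → d ≤ N → fold (N ∸ d) ≡ fold d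
  fold-reflect {d} d≤N = trans (cong ((N ∸ d) ⊓_) (m∸[m∸n]≡n d≤N)) (⊓-comm (N ∸ d) d)

  fold-small : ∀ {d} → d ≤ h → fold d ≡ d
  fold-small {d} d≤h = m≤n⇒m⊓n≡m (m+n≤o⇒m≤o∸n d (≤-trans (+-mono-≤ d≤h d≤h) (n≤1+n (h + h))))

  offset : ℕ → ℕ → ℕ
  offset x m = (x + (N ∸ m)) % N

  offset<N : ∀ x m → offset x m < N
  offset<N x m = m%n<n (x + (N ∸ m)) N

  offset-spec : ∀ {x m} → x < N → m ≤ N → (m + offset x m) % N ≡ x
  offset-spec {x} {m} x<N m≤N = begin
    (m + (x + (N ∸ m)) % N) % N  ≡⟨ [m+n%d]%d≡[m+n]%d m (x + (N ∸ m)) N ⟩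
    (m + (x + (N ∸ m))) % N      ≡⟨ cong (_% N) (x∙yz≈y∙xz m x (N ∸ m)) ⟩
    (x + (m + (N ∸ m))) % N      ≡⟨ cong (λ r → (x + r) % N) (m+[n∸m]≡n m≤N) ⟩
    (x + N) % N                  ≡⟨ [m+n]%n≡m%n x N ⟩
    x % N                        ≡⟨ m<n⇒m%n≡m x<N ⟩
    x                            ∎
    where open ≡-Reasoning

  at-infinity : ∀ {x} → x ≤ N → ¬ x < N → x ≡ N
  at-infinity x≤N x≮N = ≤-antisym x≤N (≮⇒≥ x≮N)

  label : ℕ → ℕ → ℕ
  label x m with x <? N
  ... | yes _ = fold (offset x m)
  ... | no _  = 0

  group : ℕ → ℕ
  group = fold

  finite-agree : ∀ {x x′ m} → x < N → x′ < N → m < N → x ≢ x′ →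
                 fold (offset x m) ≡ fold (offset x′ m) → (x + x′) % N ≡ (m + m) % N
  finite-agree {x} {x′} {m} x<N x′<N m<N x≢x′ agree
    with fold-injective (<⇒≤ (offset<N x m)) (<⇒≤ (offset<N x′ m)) agree
  ... | inj₁ same = contradiction (begin
    x                          ≡⟨ offset-spec x<N (<⇒≤ m<N) ⟨
    (m + offset x m) % N       ≡⟨ cong (λ d → (m + d) % N) same ⟩
    (m + offset x′ m) % N      ≡⟨ offset-spec x′<N (<⇒≤ m<N) ⟩
    x′                         ∎) x≢x′
    where open ≡-Reasoning
  ... | inj₂ sum = begin
    (x + x′) % N
      ≡⟨ cong₂ (λ y y′ → (y + y′) % N) (offset-spec x<N (<⇒≤ m<N)) (offset-spec x′<N (<⇒≤ m<N)) ⟨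
    ((m + δ) % N + (m + δ′) % N) % N                ≡⟨ %-distribˡ-+ (m + δ) (m + δ′) N ⟨
    ((m + δ) + (m + δ′)) % N                        ≡⟨ cong (_% N) (interchange m δ m δ′) ⟩
    ((m + m) + (δ + δ′)) % N                        ≡⟨ cong (λ r → (m + m + r) % N) sum ⟩
    (m + m + N) % N                                 ≡⟨ [m+n]%n≡m%n (m + m) N ⟩
    (m + m) % N                                     ∎
    where
    open ≡-Reasoning
    δ = offset x m
    δ′ = offset x′ m

  finite-label-zero : ∀ {x m} → x < N → m < N → fold (offset x m) ≡ 0 → x ≡ m
  finite-label-zero {x} {m} x<N m<N fold≡0 with fold-injective (<⇒≤ (offset<N x m)) z≤n fold≡0
  ... | inj₁ δ≡0 = begin
    x                      ≡⟨ offset-spec x<N (<⇒≤ m<N) ⟨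
    (m + offset x m) % N   ≡⟨ cong (λ d → (m + d) % N) δ≡0 ⟩
    (m + 0) % N            ≡⟨ cong (_% N) (+-identityʳ m) ⟩
    m % N                  ≡⟨ m<n⇒m%n≡m m<N ⟩
    m                      ∎
    where open ≡-Reasoning
  ... | inj₂ δ≡N = contradiction (trans (sym (+-identityʳ (offset x m))) δ≡N) (<⇒≢ (offset<N x m))

  double-injective : ∀ {m m′} → m < N → m′ < N → (m + m) % N ≡ (m′ + m′) % N → m ≡ m′
  double-injective {m} {m′} m<N m′<N eq = trans (sym (halve m<N)) (trans (cong (λ r → (suc h * r) % N) eq) (halve m′<N))
    where
    -- suc h is the inverse of 2 modulo N.
    halve : ∀ {m} → m < N → (suc h * ((m + m) % N)) % N ≡ m
    halve {m} m<N = begin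
      (suc h * ((m + m) % N)) % N  ≡⟨ [m*n%d]%d≡[m*n]%d (suc h) (m + m) N ⟩
      (suc h * (m + m)) % N        ≡⟨ cong (_% N) ([1+h]*[m+m]≡m+m*[1+h+h] h m) ⟩
      (m + m * N) % N              ≡⟨ [m+kn]%n≡m%n m m N ⟩
      m % N                        ≡⟨ m<n⇒m%n≡m m<N ⟩
      m                            ∎
      where open ≡-Reasoning

  label≤h : ∀ x m → label x m ≤ h
  label≤h x m with x <? N
  ... | yes _ = fold≤h (offset x m)
  ... | no _  = z≤n

  label-round0 : ∀ {x} → x ≤ N → label x 0 ≡ group x
  label-round0 {x} x≤N with x <? N
  ... | yes x<N = cong fold (trans ([m+n]%n≡m%n x N) (m<n⇒m%n≡m x<N))
  ... | no x≮N  = sym (trans (cong fold (at-infinity x≤N x≮N)) (trans (cong (N ⊓_) (n∸n≡0 N)) (⊓-zeroʳ N)))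

  rounds-unique : ∀ {x x′ m m′} → x ≤ N → x′ ≤ N → x ≢ x′ → m < N → m′ < N →
                  label x m ≡ label x′ m → label x m′ ≡ label x′ m′ → m ≡ m′
  rounds-unique {x} {x′} {m} {m′} x≤N x′≤N x≢x′ m<N m′<N agree agree′ with x <? N | x′ <? N
  ... | yes x<N | yes x′<N = double-injective m<N m′<N
    (trans (sym (finite-agree x<N x′<N m<N x≢x′ agree)) (finite-agree x<N x′<N m′<N x≢x′ agree′))
  ... | yes x<N | no _     = trans (sym (finite-label-zero x<N m<N agree)) (finite-label-zero x<N m′<N agree′)
  ... | no _    | yes x′<N = trans (sym (finite-label-zero x′<N m<N (sym agree))) (finite-label-zero x′<N m′<N (sym agree′))
  ... | no x≮N  | no x′≮N  = contradiction (trans (at-infinity x≤N x≮N) (sym (at-infinity x′≤N x′≮N))) x≢x′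

  partners-never-agree : ∀ {x x′ j} → x ≤ N → x′ ≤ N → x ≢ x′ → group x ≡ group x′ → j < h + h →
                         label x (suc j) ≢ label x′ (suc j)
  partners-never-agree x≤N x′≤N x≢x′ same j<2h agree = 0≢1+n (rounds-unique x≤N x′≤N x≢x′ (s≤s z≤n) (s≤s j<2h)
    (trans (label-round0 x≤N) (trans same (sym (label-round0 x′≤N)))) agree)

  group-injective-low : ∀ {x x′} → x ≤ h → x′ ≤ h → group x ≡ group x′ → x ≡ x′
  group-injective-low {x} {x′} x≤h x′≤h eq = trans (sym (fold-small x≤h)) (trans eq (fold-small x′≤h))

  group-injective-high : ∀ {x x′} → h < x → h < x′ → x ≤ N → x′ ≤ N → group x ≡ group x′ → x ≡ x′
  group-injective-high {x} {x′} h<x h<x′ x≤N x′≤N eq with fold-injective x≤N x′≤N eq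
  ... | inj₁ x≡x′ = x≡x′
  ... | inj₂ sum  = contradiction (sym sum) (<⇒≢ N<x+x′)
    where
    N<x+x′ : N < x + x′
    N<x+x′ = ≤-trans (≤-reflexive (cong suc (sym (+-suc h h)))) (+-mono-≤ h<x h<x′)

  group-member : ∀ {g} → g ≤ h → group g ≡ g × group (N ∸ g) ≡ g
  group-member g≤h = fold-small g≤h , trans (fold-reflect (≤-trans g≤h h≤N)) (fold-small g≤h)
    where
    h≤N : h ≤ N
    h≤N = ≤-trans (m≤m+n h h) (n≤1+n (h + h))

  copyIndex : ℕ → ℕ → ℕ
  copyIndex x g = dropPoint g (dropPoint (N ∸ g) x)

  module _ {g} (g≤h : g ≤ h) where

    private
      g<N∸g : g < N ∸ g
      g<N∸g = m+n≤o⇒m≤o∸n (suc g) (s≤s (+-mono-≤ g≤h g≤h))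

      outside : ∀ {x} → group x ≢ g → x ≢ g × x ≢ N ∸ g
      outside x∉g = (λ { refl → x∉g (proj₁ (group-member g≤h)) }) , (λ { refl → x∉g (proj₂ (group-member g≤h)) })

      inner≢g : ∀ {x} → group x ≢ g → dropPoint (N ∸ g) x ≢ g
      inner≢g x∉g eq = proj₁ (outside x∉g)
        (dropPoint-injective (proj₂ (outside x∉g)) (<⇒≢ g<N∸g) (trans eq (sym (dropPoint-below g<N∸g))))

    copyIndex<2h : ∀ {x} → x ≤ N → group x ≢ g → copyIndex x g < h + h
    copyIndex<2h x≤N x∉g = dropPoint-< (≤-trans g≤h (m≤m+n h h))
      (≤-pred (dropPoint-< (m∸n≤m N g) x≤N (proj₂ (outside x∉g)))) (inner≢g x∉g)

    copyIndex-injective : ∀ {x x′} → group x ≢ g → group x′ ≢ g → copyIndex x g ≡ copyIndex x′ g → x ≡ x′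
    copyIndex-injective x∉g x′∉g eq = dropPoint-injective (proj₂ (outside x∉g)) (proj₂ (outside x′∉g))
      (dropPoint-injective (inner≢g x∉g) (inner≢g x′∉g) eq)

module Acyclicity (n k M : ℕ) (a : Fin n → ℕ) where
  open Construction n k M a

  Rank : StrictPartialOrder _ _ _
  Rank = ×-strictPartialOrder <-strictPartialOrder (×-strictPartialOrder <-strictPartialOrder <-strictPartialOrder)

  open StrictPartialOrder Rank using () renaming (_<_ to _≺_)

  rank : V → ℕ × ℕ × ℕ
  rank (junc j)   = j , 0 , 0
  rank (dP j _ p) = j , 1 , p
  rank (hP i _ p) = L + i , 1 , p
  rank (hQ i p)   = L + i , 1 , p
  rank (hQ' i p)  = L + i , 2 , p
  rank (hQ'' i p) = L + i , 2 , p

  private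
    nextBlock : ∀ {b b′ s s′ p p′} → b < b′ → (b , s , p) ≺ (b′ , s′ , p′)
    nextBlock = inj₁

    nextStage : ∀ {b s s′ p p′} → s < s′ → (b , s , p) ≺ (b , s′ , p′)
    nextStage s<s′ = inj₂ (refl , inj₁ s<s′)

    nextPosition : ∀ {b s p} → (b , s , p) ≺ (b , s , suc p)
    nextPosition = inj₂ (refl , inj₂ (refl , n<1+n _))

    nextJunction : ∀ i {s s′ p p′} → (L + i , s , p) ≺ (L + suc i , s′ , p′)
    nextJunction i = nextBlock (+-monoʳ-< L (n<1+n i))

  rank-increasing : Arc u v → rank u ≺ rank v
  rank-increasing (d-in _ _)           = nextStage (s≤s z≤n)
  rank-increasing (d-step _ _ _)       = nextPosition
  rank-increasing (d-out _ _)          = nextBlock (n<1+n _)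
  rank-increasing (h-in _)             = nextStage (s≤s z≤n)
  rank-increasing (h-step _ _)         = nextPosition
  rank-increasing (h-out {i = i} _)    = nextJunction (toℕ i)
  rank-increasing q-in                 = nextStage (s≤s z≤n)
  rank-increasing (q-step _)           = nextPosition
  rank-increasing q'-in                = nextStage (s≤s (s≤s z≤n))
  rank-increasing (q'-step _)          = nextPosition
  rank-increasing (q'-out {i = i})     = nextJunction (toℕ i)
  rank-increasing q''-in               = nextStage (s≤s (s≤s z≤n))
  rank-increasing (q''-step _)         = nextPosition
  rank-increasing (q''-out {i = i})    = nextJunction (toℕ i)

  walk-is-path : (p : Walk Arc u v) → Unique (verts p)
  walk-is-path = walk-unique Rank rank rank-increasing

module Segments (n k M : ℕ) (a : Fin n → ℕ) where
  open Construction n k M a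

  data Gadget : Set where
    blockCopy hCopy      : (j c : ℕ) → Gadget
    qPath qPath' qPath'' : (i : ℕ) → Gadget
    junction             : Gadget

  vertexGadget : V → Gadget
  vertexGadget (junc _)   = junction
  vertexGadget (dP j c _) = blockCopy j c
  vertexGadget (hP i c _) = hCopy i c
  vertexGadget (hQ i _)   = qPath i
  vertexGadget (hQ' i _)  = qPath' i
  vertexGadget (hQ'' i _) = qPath'' i

  -- No arc joins two junctions, so each arc is attributed to the gadget of an inner endpoint.
  arcGadget : V × V → Gadget
  arcGadget (u , junc _) = vertexGadget u
  arcGadget (_ , v)      = vertexGadget v

  InGadget : Gadget → Walk Arc u v → Set
  InGadget γ p = All (λ e → arcGadget e ≡ γ) (arcs p)

  inGadget⇒ : ∀ {P : Gadget → Set} {γ es} → All (λ e → arcGadget e ≡ γ) es → P γ → All (P ∘ arcGadget) es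
  inGadget⇒ {P = P} inγ Pγ = All.map (λ γ≡ → subst P (sym γ≡) Pγ) inγ

  module _ {j c} (j<L : j < L) (c<k : c < k) where

    private
      blockStep : ∀ p → p < M ∸ 2 → Arc (dP j c p) (dP j c (suc p))
      blockStep p p< = d-step j<L c<k (m<n∸o⇒o+m<n 2 p<)

      blockInner : Walk Arc (dP j c 0) (dP j c (M ∸ 2))
      blockInner = walkAlong (dP j c) (M ∸ 2) blockStep

    blockWalk : Walk Arc (junc j) (junc (suc j))
    blockWalk = wrap (d-in j<L c<k) blockInner (d-out j<L c<k)

    length-blockWalk : length (arcs blockWalk) ≡ 2 + (M ∸ 2)
    length-blockWalk = trans (length-wrap (d-in j<L c<k) blockInner (d-out j<L c<k))
      (cong (2 +_) (length-walkAlong (dP j c) (M ∸ 2) blockStep))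

    blockWalk-gadget : InGadget (blockCopy j c) blockWalk
    blockWalk-gadget = All-wrap (d-in j<L c<k) blockInner (d-out j<L c<k)
      refl (All-walkAlong (dP j c) (M ∸ 2) blockStep (λ _ → refl)) refl

  module _ (i : Fin n) where

    private
      hCopyStep : ∀ {c} → c < L → ∀ p → p < M ∸ 2 → Arc (hP (toℕ i) c p) (hP (toℕ i) c (suc p))
      hCopyStep c<L p p< = h-step {i = i} c<L (m<n∸o⇒o+m<n 2 p<)

      hCopyInner : ∀ {c} → c < L → Walk Arc (hP (toℕ i) c 0) (hP (toℕ i) c (M ∸ 2))
      hCopyInner {c} c<L = walkAlong (hP (toℕ i) c) (M ∸ 2) (hCopyStep c<L)

    hCopyWalk : ∀ {c} → c < L → Walk Arc (junc (L + toℕ i)) (junc (L + suc (toℕ i)))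
    hCopyWalk c<L = wrap (h-in {i = i} c<L) (hCopyInner c<L) (h-out {i = i} c<L)

    length-hCopyWalk : ∀ {c} (c<L : c < L) → length (arcs (hCopyWalk c<L)) ≡ 2 + (M ∸ 2)
    length-hCopyWalk {c} c<L = trans (length-wrap (h-in {i = i} c<L) (hCopyInner c<L) (h-out {i = i} c<L))
      (cong (2 +_) (length-walkAlong (hP (toℕ i) c) (M ∸ 2) (hCopyStep c<L)))

    hCopyWalk-gadget : ∀ {c} (c<L : c < L) → InGadget (hCopy (toℕ i) c) (hCopyWalk c<L)
    hCopyWalk-gadget {c} c<L = All-wrap (h-in {i = i} c<L) (hCopyInner c<L) (h-out {i = i} c<L)
      refl (All-walkAlong (hP (toℕ i) c) (M ∸ 2) (hCopyStep c<L) (λ _ → refl)) refl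

    private
      qStep : ∀ p → p < a i ∸ 1 → Arc (hQ (toℕ i) p) (hQ (toℕ i) (suc p))
      qStep p p< = q-step {i = i} (m<n∸o⇒o+m<n 1 p<)

    qWalk : Walk Arc (junc (L + toℕ i)) (hQ (toℕ i) (a i ∸ 1))
    qWalk = step (q-in {i = i}) (walkAlong (hQ (toℕ i)) (a i ∸ 1) qStep)

    length-qWalk : length (arcs qWalk) ≡ suc (a i ∸ 1)
    length-qWalk = cong suc (length-walkAlong (hQ (toℕ i)) (a i ∸ 1) qStep)

    qWalk-gadget : InGadget (qPath (toℕ i)) qWalk
    qWalk-gadget = refl ∷ All-walkAlong (hQ (toℕ i)) (a i ∸ 1) qStep (λ _ → refl)

    private
      q'Step : ∀ p → p < M ∸ a i ∸ 2 → Arc (hQ' (toℕ i) p) (hQ' (toℕ i) (suc p))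
      q'Step p p< = q'-step {i = i} (m<n∸o∸2⇒1+m+o+2≤n (a i) p<)

      q''Step : ∀ p → p < M ∸ a i ∸ 2 → Arc (hQ'' (toℕ i) p) (hQ'' (toℕ i) (suc p))
      q''Step p p< = q''-step {i = i} (m<n∸o∸2⇒1+m+o+2≤n (a i) p<)

      q'Inner : Walk Arc (hQ' (toℕ i) 0) (hQ' (toℕ i) (M ∸ a i ∸ 2))
      q'Inner = walkAlong (hQ' (toℕ i)) (M ∸ a i ∸ 2) q'Step

      q''Inner : Walk Arc (hQ'' (toℕ i) 0) (hQ'' (toℕ i) (M ∸ a i ∸ 2))
      q''Inner = walkAlong (hQ'' (toℕ i)) (M ∸ a i ∸ 2) q''Step

    q'Walk q''Walk : Walk Arc (hQ (toℕ i) (a i ∸ 1)) (junc (L + suc (toℕ i)))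
    q'Walk  = wrap (q'-in {i = i}) q'Inner (q'-out {i = i})
    q''Walk = wrap (q''-in {i = i}) q''Inner (q''-out {i = i})

    length-q'Walk : length (arcs q'Walk) ≡ 2 + (M ∸ a i ∸ 2)
    length-q'Walk = trans (length-wrap (q'-in {i = i}) q'Inner (q'-out {i = i}))
      (cong (2 +_) (length-walkAlong (hQ' (toℕ i)) (M ∸ a i ∸ 2) q'Step))

    length-q''Walk : length (arcs q''Walk) ≡ 2 + (M ∸ a i ∸ 2)
    length-q''Walk = trans (length-wrap (q''-in {i = i}) q''Inner (q''-out {i = i}))
      (cong (2 +_) (length-walkAlong (hQ'' (toℕ i)) (M ∸ a i ∸ 2) q''Step))

    q'Walk-gadget : InGadget (qPath' (toℕ i)) q'Walk
    q'Walk-gadget = All-wrap (q'-in {i = i}) q'Inner (q'-out {i = i})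
      refl (All-walkAlong (hQ' (toℕ i)) (M ∸ a i ∸ 2) q'Step (λ _ → refl)) refl

    q''Walk-gadget : InGadget (qPath'' (toℕ i)) q''Walk
    q''Walk-gadget = All-wrap (q''-in {i = i}) q''Inner (q''-out {i = i})
      refl (All-walkAlong (hQ'' (toℕ i)) (M ∸ a i ∸ 2) q''Step (λ _ → refl)) refl

module PlayerPaths (n h M : ℕ) (a : Fin n → ℕ) (f : Fin n → Fin (suc h))
               (M≥2 : 2 ≤ M) (a≥1 : ∀ i → 1 ≤ a i) (a+2≤M : ∀ i → a i + 2 ≤ M) where
  open Construction n (suc h) M a
  open RoundRobin h
  open Segments n (suc h) M a

  g : Fin n → ℕ
  g i = toℕ (f i)

  g≤h : ∀ i → g i ≤ h
  g≤h i = ≤-pred (Finₚ.toℕ<n (f i))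

  L≡h+h : L ≡ h + h
  L≡h+h = cong (_∸ 2) 2[1+h]≡1+N

  private
    2+[M∸2]≡M : 2 + (M ∸ 2) ≡ M
    2+[M∸2]≡M = m+[n∸m]≡n M≥2

    length-qWalk≡a : ∀ i → length (arcs (qWalk i)) ≡ a i
    length-qWalk≡a i = trans (length-qWalk i) (m+[n∸m]≡n (a≥1 i))

    length-qWalk++ : ∀ i (rest : Walk Arc (hQ (toℕ i) (a i ∸ 1)) (junc (L + suc (toℕ i)))) →
                     length (arcs rest) ≡ 2 + (M ∸ a i ∸ 2) → length (arcs (qWalk i ++ᵂ rest)) ≡ M
    length-qWalk++ i rest |rest| = begin
      length (arcs (qWalk i ++ᵂ rest))           ≡⟨ length-++ᵂ (qWalk i) rest ⟩
      length (arcs (qWalk i)) + length (arcs rest) ≡⟨ cong₂ _+_ (length-qWalk≡a i) |rest| ⟩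
      a i + (2 + (M ∸ a i ∸ 2))                  ≡⟨ cong (a i +_) (m+[n∸m]≡n 2≤M∸aᵢ) ⟩
      a i + (M ∸ a i)                            ≡⟨ m+[n∸m]≡n (≤-trans (m≤m+n (a i) 2) (a+2≤M i)) ⟩
      M                                          ∎
      where
      open ≡-Reasoning
      2≤M∸aᵢ : 2 ≤ M ∸ a i
      2≤M∸aᵢ = m+n≤o⇒m≤o∸n 2 (subst (_≤ M) (+-comm (a i) 2) (a+2≤M i))

  module _ (x : ℕ) (x≤N : x ≤ N) where

    private
      label<k : ∀ j → label x (suc j) < suc h
      label<k j = s≤s (label≤h x (suc j))

      copyIndex<L : ∀ i → group x ≢ g i → copyIndex x (g i) < L
      copyIndex<L i x∉gᵢ = subst (copyIndex x (g i) <_) (sym L≡h+h) (copyIndex<2h (g≤h i) x≤N x∉gᵢ)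

    blockSegment : (j : Fin L) → Walk Arc (junc (toℕ j)) (junc (suc (toℕ j)))
    blockSegment j = blockWalk (Finₚ.toℕ<n j) (label<k (toℕ j))

    blockSegment-gadget : ∀ j → InGadget (blockCopy (toℕ j) (label x (suc (toℕ j)))) (blockSegment j)
    blockSegment-gadget j = blockWalk-gadget (Finₚ.toℕ<n j) (label<k (toℕ j))

    length-blockSegment : ∀ j → length (arcs (blockSegment j)) ≡ M
    length-blockSegment j = trans (length-blockWalk (Finₚ.toℕ<n j) (label<k (toℕ j))) 2+[M∸2]≡M

    qSegment : (i : Fin n) → Dec (x ≤ h) → Walk Arc (junc (L + toℕ i)) (junc (L + suc (toℕ i)))
    qSegment i (yes _) = qWalk i ++ᵂ q'Walk i
    qSegment i (no _)  = qWalk i ++ᵂ q''Walk i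

    hRoute : (i : Fin n) → Dec (group x ≡ g i) → Walk Arc (junc (L + toℕ i)) (junc (L + suc (toℕ i)))
    hRoute i (yes _)   = qSegment i (x ≤? h)
    hRoute i (no x∉gᵢ) = hCopyWalk i (copyIndex<L i x∉gᵢ)

    hCopyRoute-gadget : ∀ i (x∉gᵢ : group x ≢ g i) → InGadget (hCopy (toℕ i) (copyIndex x (g i))) (hRoute i (no x∉gᵢ))
    hCopyRoute-gadget i x∉gᵢ = hCopyWalk-gadget i (copyIndex<L i x∉gᵢ)

    hSegment : (i : Fin n) → Walk Arc (junc (L + toℕ i)) (junc (L + suc (toℕ i)))
    hSegment i = hRoute i (group x ≟ g i)

    path : Walk Arc s t
    path = concatWalks L junc blockSegment
       ++ᵂ castSource (cong junc (+-identityʳ L)) (concatWalks n (λ m → junc (L + m)) hSegment)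

    path-additive : (φ : List (V × V) → ℕ) → φ [] ≡ 0 → (∀ es fs → φ (es ++ fs) ≡ φ es + φ fs) →
                    φ (arcs path) ≡ ΣFin L (λ j → φ (arcs (blockSegment j))) + ΣFin n (λ i → φ (arcs (hSegment i)))
    path-additive φ φ[] φ++ = begin
      φ (arcs path)                        ≡⟨ cong φ (arcs-++ᵂ blockPart (castSource _ hPart)) ⟩
      φ (arcs blockPart ++ arcs (castSource _ hPart)) ≡⟨ φ++ (arcs blockPart) _ ⟩
      φ (arcs blockPart) + φ (arcs (castSource _ hPart))
        ≡⟨ cong₂ _+_ (concatWalks-additive φ φ[] φ++ L junc blockSegment)
                     (trans (cong φ (arcs-castSource _ hPart)) (concatWalks-additive φ φ[] φ++ n _ hSegment)) ⟩
      ΣFin L (λ j → φ (arcs (blockSegment j))) + ΣFin n (λ i → φ (arcs (hSegment i))) ∎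
      where
      open ≡-Reasoning
      blockPart = concatWalks L junc blockSegment
      hPart = concatWalks n (λ m → junc (L + m)) hSegment

    All-path : ∀ {P : V × V → Set} → (∀ j → All P (arcs (blockSegment j))) → (∀ i → All P (arcs (hSegment i))) →
               All P (arcs path)
    All-path Pblocks Phs = All-++ᵂ (concatWalks L junc blockSegment) _ (All-concatWalks L junc blockSegment Pblocks)
      (subst (All _) (sym (arcs-castSource _ (concatWalks n _ hSegment))) (All-concatWalks n _ hSegment Phs))

    length-path : length (arcs path) ≡ ℓ
    length-path = begin
      length (arcs path)                          ≡⟨ path-additive length refl (λ es _ → length-++ es) ⟩
      ΣFin L (λ j → length (arcs (blockSegment j))) + ΣFin n (λ i → length (arcs (hSegment i)))
        ≡⟨ cong₂ _+_ (ΣFin-cong L length-blockSegment) (ΣFin-cong n (λ i → length-hRoute i (group x ≟ g i))) ⟩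
      ΣFin L (λ _ → M) + ΣFin n (λ _ → M)         ≡⟨ cong₂ _+_ (ΣFin-const L M) (ΣFin-const n M) ⟩
      L * M + n * M                               ≡⟨ +-comm (L * M) (n * M) ⟩
      n * M + L * M                               ≡⟨ *-distribʳ-+ M n L ⟨
      ℓ                                           ∎
      where
      open ≡-Reasoning
      length-hRoute : ∀ i d → length (arcs (hRoute i d)) ≡ M
      length-hRoute i (no x∉gᵢ) = trans (length-hCopyWalk i (copyIndex<L i x∉gᵢ)) 2+[M∸2]≡M
      length-hRoute i (yes _) with x ≤? h
      ... | yes _ = length-qWalk++ i (q'Walk i) (length-q'Walk i)
      ... | no _  = length-qWalk++ i (q''Walk i) (length-q''Walk i)

  Uses : ℕ → Gadget → Set
  Uses x (blockCopy j c) = c ≡ label x (suc j)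
  Uses x (hCopy m c)     = ∃[ i ] toℕ i ≡ m × group x ≢ g i × c ≡ copyIndex x (g i)
  Uses x (qPath m)       = ∃[ i ] toℕ i ≡ m × group x ≡ g i
  Uses x (qPath' m)      = ∃[ i ] toℕ i ≡ m × group x ≡ g i × x ≤ h
  Uses x (qPath'' m)     = ∃[ i ] toℕ i ≡ m × group x ≡ g i × h < x
  Uses x junction        = ⊥

  Overlap : ℕ → ℕ → Gadget → Set
  Overlap x x′ (blockCopy j _) = label x (suc j) ≡ label x′ (suc j)
  Overlap x x′ (qPath _)       = group x ≡ group x′
  Overlap x x′ _               = ⊥

  overlap? : ∀ x x′ γ → Dec (Overlap x x′ γ)
  overlap? x x′ (blockCopy j _) = label x (suc j) ≟ label x′ (suc j)
  overlap? x x′ (qPath _)       = group x ≟ group x′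
  overlap? x x′ (hCopy _ _)     = no λ ()
  overlap? x x′ (qPath' _)      = no λ ()
  overlap? x x′ (qPath'' _)     = no λ ()
  overlap? x x′ junction        = no λ ()

  path-uses : ∀ x (x≤N : x ≤ N) → All (Uses x ∘ arcGadget) (arcs (path x x≤N))
  path-uses x x≤N = All-path x x≤N (λ j → usedThroughout (blockSegment-gadget x x≤N j) refl)
                                   (λ i → hRoute-uses i (group x ≟ g i))
    where
    usedThroughout : ∀ {γ es} → All (λ e → arcGadget e ≡ γ) es → Uses x γ → All (Uses x ∘ arcGadget) es
    usedThroughout = inGadget⇒

    hRoute-uses : ∀ i d → All (Uses x ∘ arcGadget) (arcs (hRoute x x≤N i d))
    hRoute-uses i (no x∉gᵢ) = usedThroughout (hCopyRoute-gadget x x≤N i x∉gᵢ) (i , refl , x∉gᵢ , refl)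
    hRoute-uses i (yes x∈gᵢ) with x ≤? h
    ... | yes x≤h = All-++ᵂ (qWalk i) (q'Walk i)
      (usedThroughout (qWalk-gadget i) (i , refl , x∈gᵢ)) (usedThroughout (q'Walk-gadget i) (i , refl , x∈gᵢ , x≤h))
    ... | no x≰h  = All-++ᵂ (qWalk i) (q''Walk i)
      (usedThroughout (qWalk-gadget i) (i , refl , x∈gᵢ)) (usedThroughout (q''Walk-gadget i) (i , refl , x∈gᵢ , ≰⇒> x≰h))

  shared-gadget : ∀ {x x′} → x ≤ N → x′ ≤ N → x ≢ x′ → ∀ γ → Uses x γ → Uses x′ γ → Overlap x x′ γ
  shared-gadget _ _ _ (blockCopy _ _) refl agree = agree
  shared-gadget _ _ x≢x′ (hCopy _ _) (i , refl , x∉gᵢ , refl) (i′ , i′≡i , x′∉gᵢ′ , same)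
    with Finₚ.toℕ-injective i′≡i
  ... | refl = contradiction (copyIndex-injective (g≤h i) x∉gᵢ x′∉gᵢ′ same) x≢x′
  shared-gadget _ _ _ (qPath _) (i , refl , x∈gᵢ) (i′ , i′≡i , x′∈gᵢ′) with Finₚ.toℕ-injective i′≡i
  ... | refl = trans x∈gᵢ (sym x′∈gᵢ′)
  shared-gadget _ _ x≢x′ (qPath' _) (i , refl , x∈gᵢ , x≤h) (i′ , i′≡i , x′∈gᵢ′ , x′≤h)
    with Finₚ.toℕ-injective i′≡i
  ... | refl = contradiction (group-injective-low x≤h x′≤h (trans x∈gᵢ (sym x′∈gᵢ′))) x≢x′
  shared-gadget x≤N x′≤N x≢x′ (qPath'' _) (i , refl , x∈gᵢ , h<x) (i′ , i′≡i , x′∈gᵢ′ , h<x′)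
    with Finₚ.toℕ-injective i′≡i
  ... | refl = contradiction (group-injective-high h<x h<x′ x≤N x′≤N (trans x∈gᵢ (sym x′∈gᵢ′))) x≢x′

  module _ {x x′} (x≤N : x ≤ N) (x′≤N : x′ ≤ N) (x≢x′ : x ≢ x′) where

    overlapping? : Decidable (Overlap x x′ ∘ arcGadget)
    overlapping? e = overlap? x x′ (arcGadget e)

    #overlap : Walk Arc u v → ℕ
    #overlap p = count overlapping? (arcs p)

    private
      noOverlap : ∀ {γ} (p : Walk Arc u v) → InGadget γ p → ¬ Overlap x x′ γ → #overlap p ≡ 0
      noOverlap _ inγ ¬overlap = count-none overlapping? (inGadget⇒ {P = ¬_ ∘ Overlap x x′} inγ ¬overlap)

      #overlap-++ᵂ : (p : Walk Arc u v) (q : Walk Arc v w) → #overlap (p ++ᵂ q) ≡ #overlap p + #overlap q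
      #overlap-++ᵂ p q = trans (cong (count overlapping?) (arcs-++ᵂ p q)) (count-++ overlapping? (arcs p) (arcs q))

      #overlap-path : #overlap (path x x≤N) ≡
                      ΣFin L (λ j → #overlap (blockSegment x x≤N j)) + ΣFin n (λ i → #overlap (hSegment x x≤N i))
      #overlap-path = path-additive x x≤N (count overlapping?) refl (count-++ overlapping?)

      qWalk-≤ : ∀ i (rest : Walk Arc (hQ (toℕ i) (a i ∸ 1)) (junc (L + suc (toℕ i)))) →
                #overlap rest ≡ 0 → #overlap (qWalk i ++ᵂ rest) ≤ a i
      qWalk-≤ i rest none = begin
        #overlap (qWalk i ++ᵂ rest)         ≡⟨ #overlap-++ᵂ (qWalk i) rest ⟩
        #overlap (qWalk i) + #overlap rest  ≡⟨ cong (#overlap (qWalk i) +_) none ⟩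
        #overlap (qWalk i) + 0              ≡⟨ +-identityʳ _ ⟩
        #overlap (qWalk i)                  ≤⟨ count≤length overlapping? (arcs (qWalk i)) ⟩
        length (arcs (qWalk i))             ≡⟨ length-qWalk≡a i ⟩
        a i                                 ∎
        where open ≤-Reasoning

    overlap-partners : group x ≡ group x′ → (∀ q → partSum a f q ≡ M) → #overlap (path x x≤N) ≤ M
    overlap-partners same partition = begin
      #overlap (path x x≤N)                          ≡⟨ #overlap-path ⟩
      ΣFin L (λ j → #overlap (blockSegment x x≤N j)) + ΣFin n (λ i → #overlap (hSegment x x≤N i))
        ≤⟨ +-mono-≤ (ΣFin-mono L (λ j → ≤-reflexive (block-disjoint j)))
                    (ΣFin-mono n (λ i → hRoute-≤ i (group x ≟ g i))) ⟩
      ΣFin L (λ _ → 0) + partSum a f q               ≡⟨ cong₂ _+_ (ΣFin-zero L) (partition q) ⟩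
      M                                              ∎
      where
      open ≤-Reasoning
      q : Fin (suc h)
      q = fromℕ< (s≤s (fold≤h x))

      block-disjoint : ∀ j → #overlap (blockSegment x x≤N j) ≡ 0
      block-disjoint j = noOverlap (blockSegment x x≤N j) (blockSegment-gadget x x≤N j)
        (partners-never-agree x≤N x′≤N x≢x′ same (subst (toℕ j <_) L≡h+h (Finₚ.toℕ<n j)))

      hRoute-≤ : ∀ i d → #overlap (hRoute x x≤N i d) ≤ (if does (f i Fin.≟ q) then a i else 0)
      hRoute-≤ i (no x∉gᵢ) =
        ≤-trans (≤-reflexive (noOverlap (hRoute x x≤N i (no x∉gᵢ)) (hCopyRoute-gadget x x≤N i x∉gᵢ) λ ())) z≤n
      hRoute-≤ i (yes x∈gᵢ) with f i Fin.≟ q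
      ... | no fᵢ≢q = contradiction (Finₚ.toℕ-injective (trans (sym x∈gᵢ) (sym (Finₚ.toℕ-fromℕ< _)))) fᵢ≢q
      ... | yes _ with x ≤? h
      ...   | yes _ = qWalk-≤ i (q'Walk i) (noOverlap (q'Walk i) (q'Walk-gadget i) λ ())
      ...   | no _  = qWalk-≤ i (q''Walk i) (noOverlap (q''Walk i) (q''Walk-gadget i) λ ())

    overlap-strangers : group x ≢ group x′ → #overlap (path x x≤N) ≤ M
    overlap-strangers different = begin
      #overlap (path x x≤N)                          ≡⟨ #overlap-path ⟩
      ΣFin L (λ j → #overlap (blockSegment x x≤N j)) + ΣFin n (λ i → #overlap (hSegment x x≤N i))
        ≤⟨ +-mono-≤ (ΣFin-≤-single L block-≤ single-block)
                    (ΣFin-mono n (λ i → ≤-reflexive (hRoute-disjoint i (group x ≟ g i)))) ⟩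
      M + ΣFin n (λ _ → 0)                           ≡⟨ cong (M +_) (ΣFin-zero n) ⟩
      M + 0                                          ≡⟨ +-identityʳ M ⟩
      M                                              ∎
      where
      open ≤-Reasoning
      block-≤ : ∀ j → #overlap (blockSegment x x≤N j) ≤ M
      block-≤ j = ≤-trans (count≤length overlapping? (arcs (blockSegment x x≤N j)))
                          (≤-reflexive (length-blockSegment x x≤N j))

      agrees : ∀ j → #overlap (blockSegment x x≤N j) ≢ 0 → label x (suc (toℕ j)) ≡ label x′ (suc (toℕ j))
      agrees j overlapping with label x (suc (toℕ j)) ≟ label x′ (suc (toℕ j))
      ... | yes agree   = agree
      ... | no disagree =
        contradiction (noOverlap (blockSegment x x≤N j) (blockSegment-gadget x x≤N j) disagree) overlapping

      round< : (j : Fin L) → suc (toℕ j) < N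
      round< j = s≤s (subst (toℕ j <_) L≡h+h (Finₚ.toℕ<n j))

      single-block : ∀ j j′ → #overlap (blockSegment x x≤N j) ≢ 0 → #overlap (blockSegment x x≤N j′) ≢ 0 → j ≡ j′
      single-block j j′ overlapⱼ overlapⱼ′ = Finₚ.toℕ-injective (suc-injective
        (rounds-unique x≤N x′≤N x≢x′ (round< j) (round< j′) (agrees j overlapⱼ) (agrees j′ overlapⱼ′)))

      hRoute-disjoint : ∀ i d → #overlap (hRoute x x≤N i d) ≡ 0
      hRoute-disjoint i (no x∉gᵢ) = noOverlap (hRoute x x≤N i (no x∉gᵢ)) (hCopyRoute-gadget x x≤N i x∉gᵢ) λ ()
      hRoute-disjoint i (yes _) with x ≤? h
      ... | yes _ = trans (#overlap-++ᵂ (qWalk i) (q'Walk i))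
                          (cong₂ _+_ (noOverlap (qWalk i) (qWalk-gadget i) different)
                                     (noOverlap (q'Walk i) (q'Walk-gadget i) λ ()))
      ... | no _  = trans (#overlap-++ᵂ (qWalk i) (q''Walk i))
                          (cong₂ _+_ (noOverlap (qWalk i) (qWalk-gadget i) different)
                                     (noOverlap (q''Walk i) (q''Walk-gadget i) λ ()))

    shared-arcs-≤ : (∀ q → partSum a f q ≡ M) → count (_∈? arcs (path x′ x′≤N)) (arcs (path x x≤N)) ≤ M
    shared-arcs-≤ partition = ≤-trans
      (count-mono (_∈? arcs (path x′ x′≤N)) overlapping?
        (All.map (λ {e} usedByX e∈ →
                    shared-gadget x≤N x′≤N x≢x′ (arcGadget e) usedByX (All.lookup (path-uses x′ x′≤N) e∈))
                 (path-uses x x≤N)))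
      (overlap-bound (group x ≟ group x′))
      where
      overlap-bound : Dec (group x ≡ group x′) → #overlap (path x x≤N) ≤ M
      overlap-bound (yes same)      = overlap-partners same partition
      overlap-bound (no different)  = overlap-strangers different

lemma18 : (n k M : ℕ) (a : Fin n → ℕ) →
          1 ≤ n → 2 ≤ k →
          (∀ i → 1 ≤ a i) →
          ΣFin n a ≡ k * M →
          (∀ i → a i + 2 ≤ M) →
          (f : Fin n → Fin k) → (∀ q → partSum a f q ≡ M) →
          let open Construction n k M a in
          Σ (Fin (2 * k) → Path Arc s t) λ P →
            ∀ i i' → i Fin.< i' →
              2 * ℓ ∸ 2 * M ≤ symDiffSize (arcs (proj₁ (P i))) (arcs (proj₁ (P i')))
lemma18 n zero    M a _   ()  _   _ _     _ _
lemma18 n (suc h) M a n≥1 _   a≥1 _ a+2≤M f partition = pathOf , separated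
  where
  M≥2 : 2 ≤ M
  M≥2 = m+n≤o⇒n≤o (a (fromℕ< n≥1)) (a+2≤M (fromℕ< n≥1))

  open Construction n (suc h) M a using (Arc; s; t; ℓ)
  open RoundRobin h using (N; 2[1+h]≡1+N)
  open PlayerPaths n h M a f M≥2 a≥1 a+2≤M

  player≤N : (i : Fin (2 * suc h)) → toℕ i ≤ N
  player≤N i = ≤-pred (subst (toℕ i <_) 2[1+h]≡1+N (Finₚ.toℕ<n i))

  walkOf : Fin (2 * suc h) → Walk Arc s t
  walkOf i = path (toℕ i) (player≤N i)

  pathOf : Fin (2 * suc h) → Path Arc s t
  pathOf i = walkOf i , Acyclicity.walk-is-path n (suc h) M a (walkOf i)

  separated : ∀ i i′ → i Fin.< i′ → 2 * ℓ ∸ 2 * M ≤ symDiffSize (arcs (walkOf i)) (arcs (walkOf i′))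
  separated i i′ i<i′ = symDiffSize-≥ (arcs (walkOf i)) (arcs (walkOf i′))
    (length-path (toℕ i) (player≤N i)) (length-path (toℕ i′) (player≤N i′))
    (shared-arcs-≤ (player≤N i) (player≤N i′) (<⇒≢ i<i′) partition)
    (shared-arcs-≤ (player≤N i′) (player≤N i) (≢-sym (<⇒≢ i<i′)) partition)
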